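{- Let $C$ be a deducibility constraint system and let $\theta$ be a solution for $C$. Then there exists a reduction sequence $C=C_1\leadsto_{\theta_1}C_2\leadsto_{\theta_2}\cdots\leadsto_{\theta_{m-1}}C_m=C'$ (with $m\ge 1$) such that $C'$ is in solved form and, writing $\sigma=\theta_1\circ\cdots\circ\theta_{m-1}$, there is a solution $\gamma$ of $C'$ with $x\theta=x(\sigma\circ\gamma)$ for every $x\in V(C)$.
   Context: Messages are built from countably infinite sets of names and variables using only pairing $\langle M,N\rangle$ and symmetric encryption $\{M\}_N$; equality is syntactic. $V(\cdot)$: variables occurring; ground: variable-free. Sequent rules ($\Gamma,M$ means $\Gamma\cup\{M\}$): (id) $\Gamma\vdash M$ if $M\in\Gamma$; ($p_L$) from $\Gamma,\langle M,N\rangle,M,N\vdash T$ infer $\Gamma,\langle M,N\rangle\vdash T$; ($p_R$) from $\Gamma\vdash M,\Gamma\vdash N$ infer $\Gamma\vdash\langle M,N\rangle$; ($e_L$) from $\Gamma,\{M\}_K\vdash K$ and $\Gamma,\{M\}_K,M,K\vdash N$ infer $\Gamma,\{M\}_K\vdash N$; ($e_R$) from $\Gamma\vdash M,\Gamma\vdash K$ infer $\Gamma\vdash\{M\}_K$. $\Gamma\Vdash M$: derivable; $\Gamma\Vdash_R M$: derivable using only id, $p_R$, $e_R$; $\Gamma\Vdash\Delta$: $\Gamma\Vdash N$ for all $N\in\Delta$. A deducibility constraint is $\Sigma\Vdash^?M$ (proper) or $\Sigma\Vdash^?_RM$ (right), $\Sigma$ a finite set of messages. Substitutions are applied postfix;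 composition: $M(\theta\circ\rho)=(M\theta)\rho$; $\epsilon$ is the identity. A ground substitution $\theta$ is a solution of a list $C$ of constraints if $\Sigma\theta\Vdash M\theta$ for each proper and $\Sigma\theta\Vdash_RM\theta$ for each right constraint in $C$. $C^i$: prefix of length $i-1$. A deducibility constraint system is a list $\Sigma_1\Vdash^?_{(R)}M_1;\cdots;\Sigma_n\Vdash^?_{(R)}M_n$ with: (1) for $i<j$, letting $\Sigma_j^{dv}$ be $\Sigma_j$ minus the messages containing a variable occurring in no message of $\Sigma_i$, every solution $\theta$ of $C^j$ satisfies $\Sigma_j^{dv}\theta\Vdash\Sigma_i\theta$; (2) every $x\in V(C)$ has an index $i$ with $x\in V(M_i)$, $x\notin V(\Sigma_i)$ and $x$ not occurring in any constraint of index $j<i$. Solved form: every constraint is $\Sigma\Vdash^?_R x$ with $x$ a variable. Reduction relations $\leadsto_\theta$ on lists ($\leadsto$ means $\leadsto_\epsilon$; $C_1,C_2$ arbitrary lists, $C\theta$ applies $\theta$ throughout): C1: $C_1;\Sigma\Vdash^?_RM;C_2\leadsto_\theta C_1\theta;C_2\theta$ if $M$ is not a variable and $\theta=mgu(M,N)$ (syntactic most general unifier) for some $N\in\Sigma$; C2: $C_1;\Sigma\Vdash^?_Rf(M,N);C_2\leadsto C_1;\Sigma\Vdash^?_RM;\Sigma\Vdash^?_RN;C_2$ for $f$ pairing or encryption; C3: $C_1;\Sigma\Vdash^?M;C_2\leadsto C_1;\Sigma\Vdash^?_RM;C_2$; C4: $C_1;(\Sigma,\langle M,N\rangle\Vdash^?U);C_2\leadsto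 C_1;(\Sigma,M,N\Vdash^?U);C_2$ if $\langle M,N\rangle\notin\Sigma$; C5: $C_1;(\Sigma,\{M\}_N\Vdash^?U);C_2\leadsto C_1;(\Sigma,\{M\}_N\Vdash^?_RN);(\Sigma,M,N\Vdash^?U);C_2$ if $\{M\}_N\notin\Sigma$. -}

module Defs where

open import Data.Nat using (ℕ; _≟_)
open import Data.Fin using (Fin; toℕ) renaming (_<_ to _<ᶠ_)
open import Data.List using (List; []; _∷_; _++_; map; concatMap; filter; length; lookup; take)
open import Data.List.Relation.Unary.All using (All; all?)
open import Data.List.Membership.Propositional using (_∈_; _∉_)
open import Data.List.Membership.DecPropositional _≟_ using (_∈?_)
open import Data.Product using (Σ; ∃; ∃₂; _×_; _,_)
open import Relation.Binary.PropositionalEquality using (_≡_)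
open import Relation.Nullary using (¬_)

data Msg : Set where
  name : ℕ → Msg
  var  : ℕ → Msg
  pair : Msg → Msg → Msg
  enc  : Msg → Msg → Msg     -- enc M K  is  {M}_K

vars : Msg → List ℕ
vars (name _)   = []
vars (var x)    = x ∷ []
vars (pair M N) = vars M ++ vars N
vars (enc M K)  = vars M ++ vars K

varsL : List Msg → List ℕ
varsL = concatMap vars

Ground : Msg → Set
Ground M = vars M ≡ []

-- Substitutions (applied postfix): M θ  is  sub θ M

Subst : Set
Subst = ℕ → Msg

sub : Subst → Msg → Msg
sub θ (name a)   = name a
sub θ (var x)    = θ x
sub θ (pair M N) = pair (sub θ M) (sub θ N)
sub θ (enc M K)  = enc (sub θ M) (sub θ K)

ε : Subst
ε = var

_⊙_ : Subst → Subst → Subst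
(θ ⊙ ρ) x = sub ρ (θ x)

GroundSubst : Subst → Set
GroundSubst θ = ∀ x → Ground (θ x)

IsMGU : Subst → Msg → Msg → Set
IsMGU θ M N = (sub θ M ≡ sub θ N)
            × (∀ ρ → sub ρ M ≡ sub ρ N → Σ Subst λ τ → ∀ x → ρ x ≡ sub τ (θ x))

-- Sequent calculus; a set Γ is represented by a list (only membership matters)

data _⊩_ (Γ : List Msg) : Msg → Set where
  id : ∀ {M} → M ∈ Γ → Γ ⊩ M
  pL : ∀ {M N T} → pair M N ∈ Γ → (M ∷ N ∷ Γ) ⊩ T → Γ ⊩ T
  pR : ∀ {M N} → Γ ⊩ M → Γ ⊩ N → Γ ⊩ pair M N
  eL : ∀ {M K N} → enc M K ∈ Γ → Γ ⊩ K → (M ∷ K ∷ Γ) ⊩ N → Γ ⊩ N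
  eR : ∀ {M K} → Γ ⊩ M → Γ ⊩ K → Γ ⊩ enc M K

data _⊩R_ (Γ : List Msg) : Msg → Set where
  id : ∀ {M} → M ∈ Γ → Γ ⊩R M
  pR : ∀ {M N} → Γ ⊩R M → Γ ⊩R N → Γ ⊩R pair M N
  eR : ∀ {M K} → Γ ⊩R M → Γ ⊩R K → Γ ⊩R enc M K

_⊩*_ : List Msg → List Msg → Set
Γ ⊩* Δ = All (Γ ⊩_) Δ

_≈ˢ_ : List Msg → List Msg → Set
A ≈ˢ B = ∀ z → (z ∈ A → z ∈ B) × (z ∈ B → z ∈ A)

data Kind : Set where
  proper right : Kind

record Con : Set where
  constructor ⟨_,_⊩?_⟩
  field
    kind : Kind
    hyps : List Msg
    goal : Msg
open Con public

subC : Subst → Con → Con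
subC θ ⟨ k , Γ ⊩? M ⟩ = ⟨ k , map (sub θ) Γ ⊩? sub θ M ⟩

subCs : Subst → List Con → List Con
subCs θ = map (subC θ)

varsCon : Con → List ℕ
varsCon c = varsL (hyps c) ++ vars (goal c)

varsC : List Con → List ℕ
varsC = concatMap varsCon

Sat : Subst → Con → Set
Sat θ ⟨ proper , Γ ⊩? M ⟩ = map (sub θ) Γ ⊩ sub θ M
Sat θ ⟨ right  , Γ ⊩? M ⟩ = map (sub θ) Γ ⊩R sub θ M

Solution : Subst → List Con → Set
Solution θ C = GroundSubst θ × All (Sat θ) C

-- Σ_j^dv (relative to Σ_i): drop from Σj the messages containing a
-- variable that occurs in no message of Σi
dv : List Msg → List Msg → List Msg
dv Σj Σi = filter (λ M → all? (λ x → x ∈? varsL Σi) (vars M)) Σj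

-- deducibility constraint system (0-indexed; C^j = take j C)
IsDCS : List Con → Set
IsDCS C =
    (∀ (i j : Fin (length C)) → i <ᶠ j →
       ∀ θ → Solution θ (take (toℕ j) C) →
       map (sub θ) (dv (hyps (lookup C j)) (hyps (lookup C i)))
         ⊩* map (sub θ) (hyps (lookup C i)))
  × (∀ x → x ∈ varsC C →
       ∃ λ (i : Fin (length C)) →
           x ∈ vars (goal (lookup C i))
         × x ∉ varsL (hyps (lookup C i))
         × (∀ (j : Fin (length C)) → j <ᶠ i → x ∉ varsCon (lookup C j)))

IsVar : Msg → Set
IsVar M = ∃ λ x → M ≡ var x

SolvedForm : List Con → Set
SolvedForm = All (λ c → (kind c ≡ right) × IsVar (goal c))

data _↝[_]_ : List Con → Subst → List Con → Set where
  C1 : ∀ C₁ C₂ Γ M N θ → ¬ IsVar M → N ∈ Γ → IsMGU θ M N →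
       (C₁ ++ ⟨ right , Γ ⊩? M ⟩ ∷ C₂) ↝[ θ ] (subCs θ C₁ ++ subCs θ C₂)
  C2p : ∀ C₁ C₂ Γ M N →
       (C₁ ++ ⟨ right , Γ ⊩? pair M N ⟩ ∷ C₂) ↝[ ε ]
       (C₁ ++ ⟨ right , Γ ⊩? M ⟩ ∷ ⟨ right , Γ ⊩? N ⟩ ∷ C₂)
  C2e : ∀ C₁ C₂ Γ M N →
       (C₁ ++ ⟨ right , Γ ⊩? enc M N ⟩ ∷ C₂) ↝[ ε ]
       (C₁ ++ ⟨ right , Γ ⊩? M ⟩ ∷ ⟨ right , Γ ⊩? N ⟩ ∷ C₂)
  C3 : ∀ C₁ C₂ Γ M →
       (C₁ ++ ⟨ proper , Γ ⊩? M ⟩ ∷ C₂) ↝[ ε ] (C₁ ++ ⟨ right , Γ ⊩? M ⟩ ∷ C₂)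
  -- Γ represents Σ,⟨M,N⟩ and Γ' represents Σ,M,N
  C4 : ∀ C₁ C₂ Γ Γ' Σ' M N U →
       Γ ≈ˢ (pair M N ∷ Σ') → pair M N ∉ Σ' → Γ' ≈ˢ (M ∷ N ∷ Σ') →
       (C₁ ++ ⟨ proper , Γ ⊩? U ⟩ ∷ C₂) ↝[ ε ] (C₁ ++ ⟨ proper , Γ' ⊩? U ⟩ ∷ C₂)
  -- Γ represents Σ,{M}_N and Γ' represents Σ,M,N
  C5 : ∀ C₁ C₂ Γ Γ' Σ' M N U →
       Γ ≈ˢ (enc M N ∷ Σ') → enc M N ∉ Σ' → Γ' ≈ˢ (M ∷ N ∷ Σ') →
       (C₁ ++ ⟨ proper , Γ ⊩? U ⟩ ∷ C₂) ↝[ ε ]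
       (C₁ ++ ⟨ right , Γ ⊩? N ⟩ ∷ ⟨ proper , Γ' ⊩? U ⟩ ∷ C₂)

-- reduction sequences C = C_1 ↝θ1 … ↝θ(m-1) C_m = C', σ = θ1 ∘ … ∘ θ(m-1)
data _↝*[_]_ : List Con → Subst → List Con → Set where
  done : ∀ {C} → C ↝*[ ε ] C
  step : ∀ {C C₂ C' θ σ} → C ↝[ θ ] C₂ → C₂ ↝*[ σ ] C' → C ↝*[ θ ⊙ σ ] C'

module Submission where

-- The reduction is guided by θ: we always rewrite the first unsolved
-- constraint by a rule whose result is still solved by a factor of θ.
-- Along the way we maintain an `Invariant`: solvability, condition (1)
-- instantiated by θ (`Monotone`) and condition (2) (`Originated`).  Progress:
-- a right constraint is split by C2 or closed by C1 with the mgu of two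
-- unifiable messages (`mgu`); a proper one becomes right (C3) or opens a
-- pair (C4) or a ciphertext with derivable key (C5).  If none applies, the
-- solved prefix shows that the non-variable hypotheses derive all of them
-- and form an analysed set, from which derivations are right derivations, so
-- C3 applied after all (`stuck`).  A weight measured under θ decreases.

open import Defs
open import Data.Nat using (ℕ; zero; suc; _+_; _*_; _≤_; _<_; z≤n; s≤s)
open import Data.Nat.Properties
open import Data.Fin using (toℕ) renaming (_<_ to _<ᶠ_; zero to fzero; suc to fsuc)
import Data.Fin.Properties as Fin
open import Data.List using (List; []; _∷_; _++_; map; concatMap; filter; lookup)
open import Data.List.Properties using (map-++; map-tabulate; tabulate-lookup)
open import Data.List.Relation.Unary.All as All using (All; []; _∷_; all?)
import Data.List.Relation.Unary.All.Properties as All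
open import Data.List.Relation.Unary.AllPairs as AllPairs using (AllPairs; []; _∷_)
import Data.List.Relation.Unary.AllPairs.Properties as AllPairs
open import Data.List.Relation.Unary.Any as Any using (Any; here; there)
open import Data.List.Membership.Propositional using (_∈_; _∉_; find; lose)
open import Data.List.Membership.Propositional.Properties
  using ( ∈-++⁺ˡ; ∈-++⁺ʳ; ∈-++⁻; ∈-map⁺; ∈-map⁻; ∈-filter⁺; ∈-filter⁻
        ; ∈-concatMap⁺; ∈-concatMap⁻; ∈-lookup)
open import Data.List.Membership.DecPropositional Data.Nat._≟_ using (_∈?_)
open import Data.List.Relation.Binary.Subset.Propositional using (_⊆_)
open import Data.Product using (Σ; ∃; ∃₂; _×_; _,_; proj₁; proj₂)
open import Data.Sum using (_⊎_; inj₁; inj₂)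
open import Data.Unit using (⊤; tt)
open import Data.Empty using (⊥; ⊥-elim)
open import Relation.Nullary using (¬_; ¬?; Dec; yes; no)
open import Algebra.Properties.CommutativeSemigroup +-commutativeSemigroup using (x∙yz≈y∙xz)
open import Relation.Binary using (DecidableEquality; tri<; tri≈; tri>)
open import Relation.Binary.PropositionalEquality
  using (_≡_; _≢_; refl; sym; trans; cong; cong₂; subst; subst₂; module ≡-Reasoning)

pair-injective : ∀ {a b c d} → pair a b ≡ pair c d → a ≡ c × b ≡ d
pair-injective refl = refl , refl

enc-injective : ∀ {a b c d} → enc a b ≡ enc c d → a ≡ c × b ≡ d
enc-injective refl = refl , refl

_≟M_ : DecidableEquality Msg
name a ≟M name b with a Data.Nat.≟ b
... | yes refl = yes refl
... | no a≢b = no λ { refl → a≢b refl }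
var x ≟M var y with x Data.Nat.≟ y
... | yes refl = yes refl
... | no x≢y = no λ { refl → x≢y refl }
pair a b ≟M pair c d with a ≟M c | b ≟M d
... | yes refl | yes refl = yes refl
... | no a≢c | _ = no λ { refl → a≢c refl }
... | yes _ | no b≢d = no λ { refl → b≢d refl }
enc a b ≟M enc c d with a ≟M c | b ≟M d
... | yes refl | yes refl = yes refl
... | no a≢c | _ = no λ { refl → a≢c refl }
... | yes _ | no b≢d = no λ { refl → b≢d refl }
name _ ≟M var _ = no λ ()
name _ ≟M pair _ _ = no λ ()
name _ ≟M enc _ _ = no λ ()
var _ ≟M name _ = no λ ()
var _ ≟M pair _ _ = no λ ()
var _ ≟M enc _ _ = no λ ()
pair _ _ ≟M name _ = no λ ()
pair _ _ ≟M var _ = no λ ()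
pair _ _ ≟M enc _ _ = no λ ()
enc _ _ ≟M name _ = no λ ()
enc _ _ ≟M var _ = no λ ()
enc _ _ ≟M pair _ _ = no λ ()

size : Msg → ℕ
size (name _) = 1
size (var _) = 1
size (pair M N) = suc (size M + size N)
size (enc M N) = suc (size M + size N)

size-pos : ∀ M → 1 ≤ size M
size-pos (name _) = s≤s z≤n
size-pos (var _) = s≤s z≤n
size-pos (pair _ _) = s≤s z≤n
size-pos (enc _ _) = s≤s z≤n

Factors : Subst → Subst → Subst → Set
Factors θ σ ρ = ∀ y → θ y ≡ sub ρ (σ y)

sub-cong : ∀ {θ ρ} → (∀ x → θ x ≡ ρ x) → ∀ M → sub θ M ≡ sub ρ M
sub-cong e (name a) = refl
sub-cong e (var x) = e x
sub-cong e (pair M N) = cong₂ pair (sub-cong e M) (sub-cong e N)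
sub-cong e (enc M N) = cong₂ enc (sub-cong e M) (sub-cong e N)

sub-⊙ : ∀ θ ρ M → sub (θ ⊙ ρ) M ≡ sub ρ (sub θ M)
sub-⊙ θ ρ (name a) = refl
sub-⊙ θ ρ (var x) = refl
sub-⊙ θ ρ (pair M N) = cong₂ pair (sub-⊙ θ ρ M) (sub-⊙ θ ρ N)
sub-⊙ θ ρ (enc M N) = cong₂ enc (sub-⊙ θ ρ M) (sub-⊙ θ ρ N)

sub-factor : ∀ {θ σ ρ} → Factors θ σ ρ → ∀ M → sub θ M ≡ sub ρ (sub σ M)
sub-factor {σ = σ} {ρ} f M = trans (sub-cong f M) (sub-⊙ σ ρ M)

sub-fixes : ∀ {σ} M → (∀ y → y ∈ vars M → σ y ≡ var y) → sub σ M ≡ M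
sub-fixes (name a) h = refl
sub-fixes (var x) h = h x (here refl)
sub-fixes (pair M N) h =
  cong₂ pair (sub-fixes M (λ y p → h y (∈-++⁺ˡ p))) (sub-fixes N (λ y p → h y (∈-++⁺ʳ (vars M) p)))
sub-fixes (enc M N) h =
  cong₂ enc (sub-fixes M (λ y p → h y (∈-++⁺ˡ p))) (sub-fixes N (λ y p → h y (∈-++⁺ʳ (vars M) p)))

ground-fixed : ∀ ρ M → Ground M → sub ρ M ≡ M
ground-fixed ρ M g = sub-fixes M (λ y p → ⊥-elim (no-member g p))
  where
  no-member : ∀ {xs : List ℕ} {y} → xs ≡ [] → y ∈ xs → ⊥
  no-member refl ()

sub-ground : ∀ ρ M → GroundSubst ρ → Ground (sub ρ M)
sub-ground ρ (name a) g = refl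
sub-ground ρ (var x) g = g x
sub-ground ρ (pair M N) g rewrite sub-ground ρ M g | sub-ground ρ N g = refl
sub-ground ρ (enc M N) g rewrite sub-ground ρ M g | sub-ground ρ N g = refl

vars-sub⁻ : ∀ σ M {z} → z ∈ vars (sub σ M) → ∃ λ y → y ∈ vars M × z ∈ vars (σ y)
vars-sub⁻ σ (name a) ()
vars-sub⁻ σ (var x) p = x , here refl , p
vars-sub⁻ σ (pair M N) p with ∈-++⁻ (vars (sub σ M)) p
... | inj₁ q = let (y , a , b) = vars-sub⁻ σ M q in y , ∈-++⁺ˡ a , b
... | inj₂ q = let (y , a , b) = vars-sub⁻ σ N q in y , ∈-++⁺ʳ (vars M) a , b
vars-sub⁻ σ (enc M N) p with ∈-++⁻ (vars (sub σ M)) p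
... | inj₁ q = let (y , a , b) = vars-sub⁻ σ M q in y , ∈-++⁺ˡ a , b
... | inj₂ q = let (y , a , b) = vars-sub⁻ σ N q in y , ∈-++⁺ʳ (vars M) a , b

vars-sub⁺ : ∀ σ M {y z} → y ∈ vars M → z ∈ vars (σ y) → z ∈ vars (sub σ M)
vars-sub⁺ σ (name a) () q
vars-sub⁺ σ (var x) (here refl) q = q
vars-sub⁺ σ (pair M N) p q with ∈-++⁻ (vars M) p
... | inj₁ r = ∈-++⁺ˡ (vars-sub⁺ σ M r q)
... | inj₂ r = ∈-++⁺ʳ (vars (sub σ M)) (vars-sub⁺ σ N r q)
vars-sub⁺ σ (enc M N) p q with ∈-++⁻ (vars M) p
... | inj₁ r = ∈-++⁺ˡ (vars-sub⁺ σ M r q)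
... | inj₂ r = ∈-++⁺ʳ (vars (sub σ M)) (vars-sub⁺ σ N r q)

size-occurs : ∀ θ N {x} → x ∈ vars N → size (θ x) ≤ size (sub θ N)
size-occurs θ (name a) ()
size-occurs θ (var y) (here refl) = ≤-refl
size-occurs θ (pair M N) p with ∈-++⁻ (vars M) p
... | inj₁ q = ≤-trans (size-occurs θ M q) (≤-trans (m≤m+n _ _) (n≤1+n _))
... | inj₂ q = ≤-trans (size-occurs θ N q) (≤-trans (m≤n+m _ _) (n≤1+n _))
size-occurs θ (enc M N) p with ∈-++⁻ (vars M) p
... | inj₁ q = ≤-trans (size-occurs θ M q) (≤-trans (m≤m+n _ _) (n≤1+n _))
... | inj₂ q = ≤-trans (size-occurs θ N q) (≤-trans (m≤n+m _ _) (n≤1+n _))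

size-occurs-strict : ∀ θ N {x} → x ∈ vars N → ¬ IsVar N → size (θ x) < size (sub θ N)
size-occurs-strict θ (name a) () _
size-occurs-strict θ (var y) _ nv = ⊥-elim (nv (y , refl))
size-occurs-strict θ (pair M N) p _ with ∈-++⁻ (vars M) p
... | inj₁ q = s≤s (≤-trans (size-occurs θ M q) (m≤m+n _ _))
... | inj₂ q = s≤s (≤-trans (size-occurs θ N q) (m≤n+m _ _))
size-occurs-strict θ (enc M N) p _ with ∈-++⁻ (vars M) p
... | inj₁ q = s≤s (≤-trans (size-occurs θ M q) (m≤m+n _ _))
... | inj₂ q = s≤s (≤-trans (size-occurs θ N q) (m≤n+m _ _))

MGU : Msg → Msg → Set
MGU M N = Σ Subst λ σ → IsMGU σ M N

mgu-sym : ∀ M N → MGU M N → MGU N M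
mgu-sym M N (σ , e , g) = σ , sym e , λ ρ u → g ρ (sym u)

mgu-refl : ∀ M → MGU M M
mgu-refl M = ε , refl , λ ρ _ → ρ , λ x → refl

_↦_ : ℕ → Msg → Subst
(x ↦ N) y with x Data.Nat.≟ y
... | yes _ = N
... | no _ = var y

↦-here : ∀ x N → (x ↦ N) x ≡ N
↦-here x N with x Data.Nat.≟ x
... | yes _ = refl
... | no x≢x = ⊥-elim (x≢x refl)

↦-elsewhere : ∀ x N y → x ≢ y → (x ↦ N) y ≡ var y
↦-elsewhere x N y x≢y with x Data.Nat.≟ y
... | yes x≡y = ⊥-elim (x≢y x≡y)
... | no _ = refl

-- A unifiable variable/message pair has the mgu x ↦ N (or ε if N = x):
-- unifiability forces x ∉ vars N by the occurs check.
mgu-var : ∀ x N θ → θ x ≡ sub θ N → MGU (var x) N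
mgu-var x N θ e with N ≟M var x
... | yes refl = mgu-refl (var x)
... | no N≢x = (x ↦ N) , trans (↦-here x N) (sym (sub-fixes N fixes-N)) , general
  where
  x∉N : x ∉ vars N
  x∉N p = <-irrefl (cong size e) (size-occurs-strict θ N p N-not-var)
    where
    only-var : ∀ {y} → x ∈ vars (var y) → x ≡ y
    only-var (here x≡y) = x≡y
    N-not-var : ¬ IsVar N
    N-not-var (y , N≡y) = N≢x (trans N≡y (cong var (sym (only-var (subst (λ t → x ∈ vars t) N≡y p)))))
  fixes-N : ∀ y → y ∈ vars N → (x ↦ N) y ≡ var y
  fixes-N y p = ↦-elsewhere x N y λ { refl → x∉N p }
  general : ∀ ρ → sub ρ (var x) ≡ sub ρ N → Σ Subst λ τ → ∀ y → ρ y ≡ sub τ ((x ↦ N) y)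
  general ρ u = ρ , pointwise
    where
    pointwise : ∀ y → ρ y ≡ sub ρ ((x ↦ N) y)
    pointwise y with x Data.Nat.≟ y
    ... | yes refl = u
    ... | no _ = refl

MGU₂ : Msg → Msg → Msg → Msg → Set
MGU₂ M₁ N₁ M₂ N₂ = Σ Subst λ σ → (sub σ M₁ ≡ sub σ N₁) × (sub σ M₂ ≡ sub σ N₂)
  × (∀ ρ → sub ρ M₁ ≡ sub ρ N₁ → sub ρ M₂ ≡ sub ρ N₂ → Σ Subst λ τ → Factors ρ σ τ)

-- Unifiable messages have an mgu (Robinson), by induction on the size of
-- the common instance; a pair of equations is solved one after the other.
mgu-sized : ∀ n M N θ → sub θ M ≡ sub θ N → size (sub θ M) ≤ n → MGU M N
mgu₂-sized : ∀ n M₁ N₁ M₂ N₂ θ → sub θ M₁ ≡ sub θ N₁ → sub θ M₂ ≡ sub θ N₂ →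
             size (sub θ M₁) ≤ n → size (sub θ M₂) ≤ n → MGU₂ M₁ N₁ M₂ N₂

mgu-sized n (var x) N θ e _ = mgu-var x N θ e
mgu-sized n M@(name _) (var x) θ e _ = mgu-sym (var x) M (mgu-var x M θ (sym e))
mgu-sized n M@(pair _ _) (var x) θ e _ = mgu-sym (var x) M (mgu-var x M θ (sym e))
mgu-sized n M@(enc _ _) (var x) θ e _ = mgu-sym (var x) M (mgu-var x M θ (sym e))
mgu-sized n (name a) (name b) θ refl _ = mgu-refl (name a)
mgu-sized (suc n) (pair M₁ M₂) (pair N₁ N₂) θ e (s≤s s) =
  let (e₁ , e₂) = pair-injective e
      (σ , u₁ , u₂ , g) = mgu₂-sized n M₁ N₁ M₂ N₂ θ e₁ e₂
                            (≤-trans (m≤m+n _ _) s) (≤-trans (m≤n+m _ _) s)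
  in σ , cong₂ pair u₁ u₂ , λ ρ u → let (u₁ , u₂) = pair-injective u in g ρ u₁ u₂
mgu-sized (suc n) (enc M₁ M₂) (enc N₁ N₂) θ e (s≤s s) =
  let (e₁ , e₂) = enc-injective e
      (σ , u₁ , u₂ , g) = mgu₂-sized n M₁ N₁ M₂ N₂ θ e₁ e₂
                            (≤-trans (m≤m+n _ _) s) (≤-trans (m≤n+m _ _) s)
  in σ , cong₂ enc u₁ u₂ , λ ρ u → let (u₁ , u₂) = enc-injective u in g ρ u₁ u₂
mgu-sized zero (pair _ _) (pair _ _) θ e ()
mgu-sized zero (enc _ _) (enc _ _) θ e ()
mgu-sized n (name _) (pair _ _) θ () _
mgu-sized n (name _) (enc _ _) θ () _
mgu-sized n (pair _ _) (name _) θ () _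
mgu-sized n (pair _ _) (enc _ _) θ () _
mgu-sized n (enc _ _) (name _) θ () _
mgu-sized n (enc _ _) (pair _ _) θ () _

mgu₂-sized n M₁ N₁ M₂ N₂ θ e₁ e₂ s₁ s₂ with mgu-sized n M₁ N₁ θ e₁ s₁
... | σ₁ , u₁ , g₁ with g₁ θ e₁
... | τ₁ , θ=σ₁τ₁ with mgu-sized n (sub σ₁ M₂) (sub σ₁ N₂) τ₁
                         (trans (sym (sub-factor θ=σ₁τ₁ M₂)) (trans e₂ (sub-factor θ=σ₁τ₁ N₂)))
                         (subst (λ k → size k ≤ n) (sub-factor θ=σ₁τ₁ M₂) s₂)
... | σ₂ , u₂ , g₂ =
  σ₁ ⊙ σ₂ ,
  trans (sub-⊙ σ₁ σ₂ M₁) (trans (cong (sub σ₂) u₁) (sym (sub-⊙ σ₁ σ₂ N₁))) ,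
  trans (sub-⊙ σ₁ σ₂ M₂) (trans u₂ (sym (sub-⊙ σ₁ σ₂ N₂))) ,
  general
  where
  general : ∀ ρ → sub ρ M₁ ≡ sub ρ N₁ → sub ρ M₂ ≡ sub ρ N₂ →
            Σ Subst λ τ → Factors ρ (σ₁ ⊙ σ₂) τ
  general ρ a b with g₁ ρ a
  ... | τa , ρ=σ₁τa with g₂ τa (trans (sym (sub-factor ρ=σ₁τa M₂)) (trans b (sub-factor ρ=σ₁τa N₂)))
  ... | τb , τa=σ₂τb = τb , λ x → trans (ρ=σ₁τa x) (sub-factor τa=σ₂τb (σ₁ x))

mgu : ∀ θ M N → sub θ M ≡ sub θ N → MGU M N
mgu θ M N e = mgu-sized (size (sub θ M)) M N θ e ≤-refl

there₂ : ∀ {Γ : List Msg} {a b} → Γ ⊆ a ∷ b ∷ Γ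
there₂ p = there (there p)

∷-⊆ : ∀ {Γ Γ' : List Msg} {a} → Γ ⊆ Γ' → a ∷ Γ ⊆ a ∷ Γ'
∷-⊆ s (here p) = here p
∷-⊆ s (there p) = there (s p)

weaken : ∀ {Γ Γ' T} → Γ ⊆ Γ' → Γ ⊩ T → Γ' ⊩ T
weaken s (id m) = id (s m)
weaken s (pL m d) = pL (s m) (weaken (∷-⊆ (∷-⊆ s)) d)
weaken s (pR a b) = pR (weaken s a) (weaken s b)
weaken s (eL m k d) = eL (s m) (weaken s k) (weaken (∷-⊆ (∷-⊆ s)) d)
weaken s (eR a b) = eR (weaken s a) (weaken s b)

weakenR : ∀ {Γ Γ' T} → Γ ⊆ Γ' → Γ ⊩R T → Γ' ⊩R T
weakenR s (id m) = id (s m)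
weakenR s (pR a b) = pR (weakenR s a) (weakenR s b)
weakenR s (eR a b) = eR (weakenR s a) (weakenR s b)

weaken* : ∀ {Γ Γ' Δ} → Γ ⊆ Γ' → Γ ⊩* Δ → Γ' ⊩* Δ
weaken* s = All.map (weaken s)

⊩*-⊆ : ∀ {Γ Δ} → Δ ⊆ Γ → Γ ⊩* Δ
⊩*-⊆ s = All.tabulate (λ m → id (s m))

⊩R⇒⊩ : ∀ {Γ T} → Γ ⊩R T → Γ ⊩ T
⊩R⇒⊩ (id m) = id m
⊩R⇒⊩ (pR a b) = pR (⊩R⇒⊩ a) (⊩R⇒⊩ b)
⊩R⇒⊩ (eR a b) = eR (⊩R⇒⊩ a) (⊩R⇒⊩ b)

fst⊩ : ∀ {Γ M N} → Γ ⊩ pair M N → Γ ⊩ M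
fst⊩ (id m) = pL m (id (here refl))
fst⊩ (pL m d) = pL m (fst⊩ d)
fst⊩ (pR a b) = a
fst⊩ (eL m k d) = eL m k (fst⊩ d)

snd⊩ : ∀ {Γ M N} → Γ ⊩ pair M N → Γ ⊩ N
snd⊩ (id m) = pL m (id (there (here refl)))
snd⊩ (pL m d) = pL m (snd⊩ d)
snd⊩ (pR a b) = b
snd⊩ (eL m k d) = eL m k (snd⊩ d)

decrypt⊩ : ∀ {Γ M K} → Γ ⊩ enc M K → Γ ⊩ K → Γ ⊩ M
decrypt⊩ (id m) k = eL m k (id (here refl))
decrypt⊩ (pL m d) k = pL m (decrypt⊩ d (weaken there₂ k))
decrypt⊩ (eL m k' d) k = eL m k' (decrypt⊩ d (weaken there₂ k))
decrypt⊩ (eR a b) k = a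

-- Cut: hypotheses of Γ' taken from Δ may be replaced by their derivations
-- from Γ.  The split of Γ' into Δ and Γ is carried along the left rules.
Split : List Msg → List Msg → List Msg → Set
Split Γ' Δ Γ = ∀ {z} → z ∈ Γ' → z ∈ Δ ⊎ z ∈ Γ

split-to-Δ : ∀ {Γ' Δ Γ a b} → Split Γ' Δ Γ → Split (a ∷ b ∷ Γ') (a ∷ b ∷ Δ) Γ
split-to-Δ s (here p) = inj₁ (here p)
split-to-Δ s (there (here p)) = inj₁ (there (here p))
split-to-Δ s (there (there p)) with s p
... | inj₁ q = inj₁ (there (there q))
... | inj₂ q = inj₂ q

split-to-Γ : ∀ {Γ' Δ Γ a b} → Split Γ' Δ Γ → Split (a ∷ b ∷ Γ') Δ (a ∷ b ∷ Γ)
split-to-Γ s (here p) = inj₂ (here p)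
split-to-Γ s (there (here p)) = inj₂ (there (here p))
split-to-Γ s (there (there p)) with s p
... | inj₁ q = inj₁ q
... | inj₂ q = inj₂ (there (there q))

cut : ∀ {Γ Δ Γ' T} → Γ ⊩* Δ → Γ' ⊩ T → Split Γ' Δ Γ → Γ ⊩ T
cut h (id m) s with s m
... | inj₁ q = All.lookup h q
... | inj₂ q = id q
cut h (pL m d) s with s m
... | inj₁ q = let p = All.lookup h q in cut (fst⊩ p ∷ snd⊩ p ∷ h) d (split-to-Δ s)
... | inj₂ q = pL q (cut (weaken* there₂ h) d (split-to-Γ s))
cut h (pR a b) s = pR (cut h a s) (cut h b s)
cut h (eR a b) s = eR (cut h a s) (cut h b s)
cut h (eL m dk d) s with cut h dk s | s m
... | k | inj₁ q = cut (decrypt⊩ (All.lookup h q) k ∷ k ∷ h) d (split-to-Δ s)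
... | k | inj₂ q = eL q k (cut (weaken* there₂ h) d (split-to-Γ s))

⊩-trans : ∀ {Γ Δ T} → Γ ⊩* Δ → Δ ⊩ T → Γ ⊩ T
⊩-trans h d = cut h d inj₁

⊩*-trans : ∀ {Γ Δ E} → Γ ⊩* Δ → Δ ⊩* E → Γ ⊩* E
⊩*-trans h = All.map (⊩-trans h)

⊩R? : ∀ Γ T → Dec (Γ ⊩R T)
⊩R? Γ T with Any.any? (T ≟M_) Γ
... | yes m = yes (id m)
... | no T∉Γ = compose T T∉Γ
  where
  compose : ∀ T → T ∉ Γ → Dec (Γ ⊩R T)
  compose (name a) T∉Γ = no λ { (id m) → T∉Γ m }
  compose (var x) T∉Γ = no λ { (id m) → T∉Γ m }
  compose (pair A B) T∉Γ with ⊩R? Γ A | ⊩R? Γ B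
  ... | yes a | yes b = yes (pR a b)
  ... | no ¬a | _ = no λ { (id m) → T∉Γ m ; (pR a b) → ¬a a }
  ... | yes _ | no ¬b = no λ { (id m) → T∉Γ m ; (pR a b) → ¬b b }
  compose (enc A B) T∉Γ with ⊩R? Γ A | ⊩R? Γ B
  ... | yes a | yes b = yes (eR a b)
  ... | no ¬a | _ = no λ { (id m) → T∉Γ m ; (eR a b) → ¬a a }
  ... | yes _ | no ¬b = no λ { (id m) → T∉Γ m ; (eR a b) → ¬b b }

Analysed : List Msg → Set
Analysed Γ = (∀ {A B} → pair A B ∉ Γ) × (∀ {A B} → enc A B ∈ Γ → ¬ (Γ ⊩R B))

analysed⇒right : ∀ {Γ T} → Analysed Γ → Γ ⊩ T → Γ ⊩R T
analysed⇒right an (id m) = id m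
analysed⇒right an (pL m d) = ⊥-elim (proj₁ an m)
analysed⇒right an (pR a b) = pR (analysed⇒right an a) (analysed⇒right an b)
analysed⇒right an (eR a b) = eR (analysed⇒right an a) (analysed⇒right an b)
analysed⇒right an (eL m k d) = ⊥-elim (proj₂ an m (analysed⇒right an k))

module _ {A : Set} (f : A → List ℕ) where

  ∈-concatMap-∃ : ∀ xs {x} → x ∈ concatMap f xs → ∃ λ a → a ∈ xs × x ∈ f a
  ∈-concatMap-∃ xs p = find (∈-concatMap⁻ f {xs = xs} p)

  ∃-∈-concatMap : ∀ xs {x a} → a ∈ xs → x ∈ f a → x ∈ concatMap f xs
  ∃-∈-concatMap xs m q = ∈-concatMap⁺ f (lose m q)

varsL⁻ : ∀ Γ {x} → x ∈ varsL Γ → ∃ λ e → e ∈ Γ × x ∈ vars e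
varsL⁻ = ∈-concatMap-∃ vars

varsL⁺ : ∀ Γ {x e} → e ∈ Γ → x ∈ vars e → x ∈ varsL Γ
varsL⁺ = ∃-∈-concatMap vars

varsC⁺ : ∀ D {x c} → c ∈ D → x ∈ varsCon c → x ∈ varsC D
varsC⁺ = ∃-∈-concatMap varsCon

varsL-sub⁻ : ∀ σ Γ {z} → z ∈ varsL (map (sub σ) Γ) → ∃ λ y → y ∈ varsL Γ × z ∈ vars (σ y)
varsL-sub⁻ σ Γ p with varsL⁻ (map (sub σ) Γ) p
... | _ , m , q with ∈-map⁻ (sub σ) m
... | e , e∈Γ , refl with vars-sub⁻ σ e q
... | y , a , b = y , varsL⁺ Γ e∈Γ a , b

varsL-sub⁺ : ∀ σ Γ {y z} → y ∈ varsL Γ → z ∈ vars (σ y) → z ∈ varsL (map (sub σ) Γ)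
varsL-sub⁺ σ Γ p q with varsL⁻ Γ p
... | e , m , r = varsL⁺ (map (sub σ) Γ) (∈-map⁺ (sub σ) m) (vars-sub⁺ σ e r q)

varsCon-sub⁺ : ∀ σ c {y z} → y ∈ varsCon c → z ∈ vars (σ y) → z ∈ varsCon (subC σ c)
varsCon-sub⁺ σ ⟨ k , Γ ⊩? M ⟩ p q with ∈-++⁻ (varsL Γ) p
... | inj₁ r = ∈-++⁺ˡ (varsL-sub⁺ σ Γ r q)
... | inj₂ r = ∈-++⁺ʳ (varsL (map (sub σ) Γ)) (vars-sub⁺ σ M r q)

varsC-sub⁺ : ∀ σ D {y z} → y ∈ varsC D → z ∈ vars (σ y) → z ∈ varsC (subCs σ D)
varsC-sub⁺ σ D p q with ∈-concatMap-∃ varsCon D p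
... | c , m , r = varsC⁺ (subCs σ D) (∈-map⁺ (subC σ) m) (varsCon-sub⁺ σ c r q)

module _ {A : Set} where

  AllPairs-replace : ∀ {R : A → A → Set} S {x} Y {T} → AllPairs R (S ++ x ∷ T) →
    (∀ {a} → R a x → All (R a) Y) → (∀ {b} → R x b → All (λ y → R y b) Y) → AllPairs R Y →
    AllPairs R (S ++ Y ++ T)
  AllPairs-replace [] Y (x~T ∷ T!) before after Y! = AllPairs.++⁺ Y! T! (All.All-swap (All.map after x~T))
  AllPairs-replace (s ∷ S) Y (s~ ∷ rest) before after Y! =
    let (s~S , s~x , s~T) = split-at-x s~ in
    All.++⁺ s~S (All.++⁺ (before s~x) s~T) ∷ AllPairs-replace S Y rest before after Y!
    where
    split-at-x : ∀ {P : A → Set} {x T} → All P (S ++ x ∷ T) → All P S × P x × All P T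
    split-at-x h = let (a , b) = All.++⁻ S h in a , All.head b , All.tail b

  All-replace : ∀ {P : A → Set} S {x} Y {T} → All P (S ++ x ∷ T) → All P Y → All P (S ++ Y ++ T)
  All-replace S Y h y = let (a , b) = All.++⁻ S h in All.++⁺ a (All.++⁺ y (All.tail b))

  AllPairs-before : ∀ {R : A → A → Set} S {x T} → AllPairs R (S ++ x ∷ T) → All (λ a → R a x) S
  AllPairs-before [] _ = []
  AllPairs-before (a ∷ S) (h ∷ t) = All.head (All.++⁻ʳ S h) ∷ AllPairs-before S t

inst : Subst → List Msg → List Msg
inst θ = map (sub θ)

inst-⊆ : ∀ θ {A B} → A ⊆ B → inst θ A ⊆ inst θ B
inst-⊆ θ s p with ∈-map⁻ (sub θ) p
... | e , m , refl = ∈-map⁺ (sub θ) (s m)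

inst-factor : ∀ {θ σ θ'} → Factors θ σ θ' → ∀ Γ → inst θ' (inst σ Γ) ≡ inst θ Γ
inst-factor f [] = refl
inst-factor f (e ∷ Γ) = cong₂ _∷_ (sym (sub-factor f e)) (inst-factor f Γ)

OnlyVarsOf : List Msg → Msg → Set
OnlyVarsOf Σi e = ∀ {x} → x ∈ vars e → x ∈ varsL Σi

dv⁺ : ∀ Σj Σi {e} → e ∈ Σj → OnlyVarsOf Σi e → e ∈ dv Σj Σi
dv⁺ Σj Σi m f = ∈-filter⁺ (λ e → all? (_∈? varsL Σi) (vars e)) m (All.tabulate f)

dv⁻ : ∀ Σj Σi {e} → e ∈ dv Σj Σi → e ∈ Σj × OnlyVarsOf Σi e
dv⁻ Σj Σi m = let (a , b) = ∈-filter⁻ (λ e → all? (_∈? varsL Σi) (vars e)) m in a , All.lookup b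

dv-anti : ∀ B A A' → varsL A ⊆ varsL A' → dv B A ⊆ dv B A'
dv-anti B A A' f m = let (a , b) = dv⁻ B A m in dv⁺ B A' a (λ p → f (b p))

-- Invariant 1, condition (1) of a constraint system instantiated by θ: the
-- instance of Σi is derivable from the part of Σj over variables of Σi.
DvDerives : Subst → List Msg → List Msg → Set
DvDerives θ Σi Σj = inst θ (dv Σj Σi) ⊩* inst θ Σi

Monotone : Subst → List Con → Set
Monotone θ D = AllPairs (DvDerives θ) (map hyps D)

DvDerives-refl : ∀ θ Γ → DvDerives θ Γ Γ
DvDerives-refl θ Γ = ⊩*-⊆ (inst-⊆ θ (λ m → dv⁺ Γ Γ m (varsL⁺ Γ m)))

DvDerives-sub : ∀ {θ σ θ'} → Factors θ σ θ' → ∀ {Σi Σj} →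
                DvDerives θ Σi Σj → DvDerives θ' (inst σ Σi) (inst σ Σj)
DvDerives-sub {θ} {σ} {θ'} f {Σi} {Σj} r =
  subst (_ ⊩*_) (sym (inst-factor f Σi)) (weaken* dv-inst r)
  where
  dv-inst : inst θ (dv Σj Σi) ⊆ inst θ' (dv (inst σ Σj) (inst σ Σi))
  dv-inst p with ∈-map⁻ (sub θ) p
  ... | e , m , refl with dv⁻ Σj Σi m
  ... | e∈Σj , only = subst (_∈ _) (sym (sub-factor f e))
          (∈-map⁺ (sub θ') (dv⁺ (inst σ Σj) (inst σ Σi) (∈-map⁺ (sub σ) e∈Σj) only-σ))
    where
    only-σ : OnlyVarsOf (inst σ Σi) (sub σ e)
    only-σ q = let (y , a , b) = vars-sub⁻ σ e q in varsL-sub⁺ σ Σi (only a) b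

Monotone-replace : ∀ {θ} S {c} Y R → Monotone θ (S ++ c ∷ R) →
  (∀ {a} → DvDerives θ a (hyps c) → All (DvDerives θ a) (map hyps Y)) →
  (∀ {b} → DvDerives θ (hyps c) b → All (λ y → DvDerives θ y b) (map hyps Y)) →
  AllPairs (DvDerives θ) (map hyps Y) → Monotone θ (S ++ Y ++ R)
Monotone-replace {θ} S {c} Y R h before after Y! =
  subst (AllPairs (DvDerives θ)) (sym hyps-SYR)
    (AllPairs-replace (map hyps S) (map hyps Y) (subst (AllPairs (DvDerives θ)) (map-++ hyps S (c ∷ R)) h)
      (λ {a} → before {a}) (λ {b} → after {b}) Y!)
  where
  hyps-SYR : map hyps (S ++ Y ++ R) ≡ map hyps S ++ map hyps Y ++ map hyps R
  hyps-SYR = trans (map-++ hyps S (Y ++ R)) (cong (map hyps S ++_) (map-++ hyps Y R))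

VarSet : Set₁
VarSet = ℕ → Set

∅ : VarSet
∅ _ = ⊥

_∪_ : VarSet → VarSet → VarSet
(K ∪ L) x = K x ⊎ L x

⟦_⟧ : List ℕ → VarSet
⟦ xs ⟧ x = x ∈ xs

-- Every variable of the hypotheses of a constraint lies in K or occurs in an
-- earlier constraint (condition (2) of a constraint system, relative to K).
Originated : VarSet → List Con → Set
Originated K [] = ⊤
Originated K (c ∷ D) = (∀ x → x ∈ varsL (hyps c) → K x) × Originated (K ∪ ⟦ varsCon c ⟧) D

Originated-mono : ∀ {K K'} D → (∀ x → K x → K' x) → Originated K D → Originated K' D
Originated-mono [] f _ = tt
Originated-mono (c ∷ D) f (h , t) =
  (λ x p → f x (h x p)) , Originated-mono D (λ { x (inj₁ a) → inj₁ (f x a) ; x (inj₂ b) → inj₂ b }) t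

Originated-++⁻ : ∀ {K} A {B} → Originated K (A ++ B) → Originated K A × Originated (K ∪ ⟦ varsC A ⟧) B
Originated-++⁻ [] {B} h = tt , Originated-mono B (λ x → inj₁) h
Originated-++⁻ (c ∷ A) {B} (h , t) =
  let (a , b) = Originated-++⁻ A t in
  (h , a) , Originated-mono B (λ { x (inj₁ (inj₁ k)) → inj₁ k
                                 ; x (inj₁ (inj₂ v)) → inj₂ (∈-++⁺ˡ v)
                                 ; x (inj₂ v) → inj₂ (∈-++⁺ʳ (varsCon c) v) }) b

Originated-++⁺ : ∀ {K} A {B} → Originated K A → Originated (K ∪ ⟦ varsC A ⟧) B → Originated K (A ++ B)
Originated-++⁺ [] {B} a b = Originated-mono B (λ { x (inj₁ k) → k ; x (inj₂ ()) }) b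
Originated-++⁺ {K} (c ∷ A) {B} (h , a) b = h , Originated-++⁺ A a (Originated-mono B regroup b)
  where
  regroup : ∀ x → (K ∪ ⟦ varsC (c ∷ A) ⟧) x → ((K ∪ ⟦ varsCon c ⟧) ∪ ⟦ varsC A ⟧) x
  regroup x (inj₁ k) = inj₁ (inj₁ k)
  regroup x (inj₂ v) with ∈-++⁻ (varsCon c) v
  ... | inj₁ w = inj₁ (inj₂ w)
  ... | inj₂ w = inj₂ w

Originated-replace : ∀ {K} S {c} Y {R} → Originated K (S ++ c ∷ R) →
  (∀ {K'} → (∀ x → x ∈ varsL (hyps c) → K' x) → Originated K' Y) →
  varsCon c ⊆ varsC Y → Originated K (S ++ Y ++ R)
Originated-replace S {c} Y {R} h Y-orig c⊆Y =
  let (a , (hc , r)) = Originated-++⁻ S h in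
  Originated-++⁺ S a (Originated-++⁺ Y (Y-orig hc)
    (Originated-mono R (λ { x (inj₁ k) → inj₁ k ; x (inj₂ v) → inj₂ (c⊆Y v) }) r))

Originated-sub : ∀ {K K'} σ D → Originated K D → (∀ y → K y → ∀ z → z ∈ vars (σ y) → K' z) →
                 Originated K' (subCs σ D)
Originated-sub σ [] _ _ = tt
Originated-sub {K} {K'} σ (c ∷ D) (h , t) f = hyps-σ , Originated-sub σ D t f'
  where
  hyps-σ : ∀ z → z ∈ varsL (hyps (subC σ c)) → K' z
  hyps-σ z p = let (y , a , b) = varsL-sub⁻ σ (hyps c) p in f y (h y a) z b
  f' : ∀ y → (K ∪ ⟦ varsCon c ⟧) y → ∀ z → z ∈ vars (σ y) → (K' ∪ ⟦ varsCon (subC σ c) ⟧) z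
  f' y (inj₁ k) z q = inj₁ (f y k z q)
  f' y (inj₂ v) z q = inj₂ (varsCon-sub⁺ σ c v q)

hypsSize : Subst → List Msg → ℕ
hypsSize θ [] = 0
hypsSize θ (e ∷ Γ) = size (sub θ e) + hypsSize θ Γ

-- The weight of a proper constraint is quadratic in its hypotheses, so that
-- opening a hypothesis pays even for the key constraint added by C5.
weight : Subst → Con → ℕ
weight θ ⟨ right , Γ ⊩? M ⟩ = size (sub θ M)
weight θ ⟨ proper , Γ ⊩? M ⟩ = suc (hypsSize θ Γ) * suc (hypsSize θ Γ) + size (sub θ M)

W : Subst → List Con → ℕ
W θ [] = 0
W θ (c ∷ D) = weight θ c + W θ D

W-++ : ∀ θ A B → W θ (A ++ B) ≡ W θ A + W θ B
W-++ θ [] B = refl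
W-++ θ (c ∷ A) B = trans (cong (weight θ c +_) (W-++ θ A B)) (sym (+-assoc (weight θ c) _ _))

W-replace : ∀ θ S {c} Y R → W θ Y < weight θ c → W θ (S ++ Y ++ R) < W θ (S ++ c ∷ R)
W-replace θ S {c} Y R lt =
  subst₂ _<_ (sym (trans (W-++ θ S (Y ++ R)) (cong (W θ S +_) (W-++ θ Y R))))
             (sym (W-++ θ S (c ∷ R)))
             (+-monoʳ-< (W θ S) (+-monoˡ-< (W θ R) lt))

W-sub : ∀ {θ σ θ'} → Factors θ σ θ' → ∀ D → W θ' (subCs σ D) ≡ W θ D
W-sub f [] = refl
W-sub {θ} {σ} {θ'} f (c ∷ D) = cong₂ _+_ (weight-sub c) (W-sub f D)
  where
  hypsSize-sub : ∀ Γ → hypsSize θ' (inst σ Γ) ≡ hypsSize θ Γ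
  hypsSize-sub [] = refl
  hypsSize-sub (e ∷ Γ) = cong₂ _+_ (cong size (sym (sub-factor f e))) (hypsSize-sub Γ)
  weight-sub : ∀ c → weight θ' (subC σ c) ≡ weight θ c
  weight-sub ⟨ right , Γ ⊩? M ⟩ = cong size (sym (sub-factor f M))
  weight-sub ⟨ proper , Γ ⊩? M ⟩ =
    cong₂ (λ a b → suc a * suc a + b) (hypsSize-sub Γ) (cong size (sym (sub-factor f M)))

-- C4 and C5 describe the opened hypotheses up to set equality.
≈ˢ-refl : ∀ {Γ} → Γ ≈ˢ Γ
≈ˢ-refl z = (λ p → p) , (λ p → p)

remove : Msg → List Msg → List Msg
remove e [] = []
remove e (x ∷ Γ) with x ≟M e
... | yes _ = remove e Γ
... | no _ = x ∷ remove e Γ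

remove⁻ : ∀ {e z} Γ → z ∈ remove e Γ → z ∈ Γ × z ≢ e
remove⁻ {e} (x ∷ Γ) p with x ≟M e
... | yes _ = let (a , b) = remove⁻ Γ p in there a , b
remove⁻ {e} (x ∷ Γ) (here refl) | no x≢e = here refl , x≢e
remove⁻ {e} (x ∷ Γ) (there p) | no _ = let (a , b) = remove⁻ Γ p in there a , b

remove⁺ : ∀ {e z} Γ → z ∈ Γ → z ≡ e ⊎ z ∈ remove e Γ
remove⁺ {e} (x ∷ Γ) p with x ≟M e
remove⁺ {e} (x ∷ Γ) (here refl) | yes x≡e = inj₁ x≡e
remove⁺ {e} (x ∷ Γ) (there p) | yes _ = remove⁺ Γ p
remove⁺ {e} (x ∷ Γ) (here refl) | no _ = inj₂ (here refl)
remove⁺ {e} (x ∷ Γ) (there p) | no _ with remove⁺ Γ p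
... | inj₁ q = inj₁ q
... | inj₂ q = inj₂ (there q)

hypsSize-remove≤ : ∀ θ e Γ → hypsSize θ (remove e Γ) ≤ hypsSize θ Γ
hypsSize-remove≤ θ e [] = z≤n
hypsSize-remove≤ θ e (x ∷ Γ) with x ≟M e
... | yes _ = ≤-trans (hypsSize-remove≤ θ e Γ) (m≤n+m _ _)
... | no _ = +-monoʳ-≤ (size (sub θ x)) (hypsSize-remove≤ θ e Γ)

hypsSize-remove : ∀ θ e Γ → e ∈ Γ → size (sub θ e) + hypsSize θ (remove e Γ) ≤ hypsSize θ Γ
hypsSize-remove θ e (x ∷ Γ) p with x ≟M e
hypsSize-remove θ e (x ∷ Γ) p | yes refl = +-monoʳ-≤ (size (sub θ x)) (hypsSize-remove≤ θ e Γ)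
hypsSize-remove θ e (x ∷ Γ) (here refl) | no x≢e = ⊥-elim (x≢e refl)
hypsSize-remove θ e (x ∷ Γ) (there p) | no _ =
  ≤-trans (≤-reflexive (x∙yz≈y∙xz (size (sub θ e)) (size (sub θ x)) _))
          (+-monoʳ-≤ (size (sub θ x)) (hypsSize-remove θ e Γ p))

record Built (e M N : Msg) : Set where
  field
    vars-e : ∀ {x} → x ∈ vars e → x ∈ vars M ⊎ x ∈ vars N
    vars-M : vars M ⊆ vars e
    vars-N : vars N ⊆ vars e
    compose : ∀ {θ Δ} → Δ ⊩ sub θ M → Δ ⊩ sub θ N → Δ ⊩ sub θ e
    size-e : ∀ θ → size (sub θ e) ≡ suc (size (sub θ M) + size (sub θ N))

built-pair : ∀ M N → Built (pair M N) M N
built-pair M N = record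
  { vars-e = ∈-++⁻ (vars M) ; vars-M = ∈-++⁺ˡ ; vars-N = ∈-++⁺ʳ (vars M)
  ; compose = pR ; size-e = λ θ → refl }

built-enc : ∀ M N → Built (enc M N) M N
built-enc M N = record
  { vars-e = ∈-++⁻ (vars M) ; vars-M = ∈-++⁺ˡ ; vars-N = ∈-++⁺ʳ (vars M)
  ; compose = eR ; size-e = λ θ → refl }

module Opening {e M N : Msg} (b : Built e M N) (Γ : List Msg) (e∈Γ : e ∈ Γ) where
  open Built b

  Γ' : List Msg
  Γ' = M ∷ N ∷ remove e Γ

  Γ≈e∷rest : Γ ≈ˢ (e ∷ remove e Γ)
  Γ≈e∷rest z = to , from
    where
    to : z ∈ Γ → z ∈ e ∷ remove e Γ
    to p with remove⁺ {e} Γ p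
    ... | inj₁ z≡e = here z≡e
    ... | inj₂ q = there q
    from : z ∈ e ∷ remove e Γ → z ∈ Γ
    from (here refl) = e∈Γ
    from (there p) = proj₁ (remove⁻ Γ p)

  e∉rest : e ∉ remove e Γ
  e∉rest p = proj₂ (remove⁻ Γ p) refl

  varsΓ⊆varsΓ' : varsL Γ ⊆ varsL Γ'
  varsΓ⊆varsΓ' p with varsL⁻ Γ p
  ... | e' , m , q with remove⁺ {e} Γ m
  ... | inj₂ r = varsL⁺ Γ' (there (there r)) q
  ... | inj₁ refl with vars-e q
  ...   | inj₁ r = varsL⁺ Γ' (here refl) r
  ...   | inj₂ r = varsL⁺ Γ' (there (here refl)) r

  varsΓ'⊆varsΓ : varsL Γ' ⊆ varsL Γ
  varsΓ'⊆varsΓ p with varsL⁻ Γ' p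
  ... | _ , here refl , q = varsL⁺ Γ e∈Γ (vars-M q)
  ... | _ , there (here refl) , q = varsL⁺ Γ e∈Γ (vars-N q)
  ... | _ , there (there m) , q = varsL⁺ Γ (proj₁ (remove⁻ Γ m)) q

  Γ'⊩Γ : ∀ θ → inst θ Γ' ⊩* inst θ Γ
  Γ'⊩Γ θ = All.tabulate derive
    where
    derive : ∀ {z} → z ∈ inst θ Γ → inst θ Γ' ⊩ z
    derive p with ∈-map⁻ (sub θ) p
    ... | e' , m , refl with remove⁺ {e} Γ m
    ... | inj₁ refl = compose {θ} (id (here refl)) (id (there (here refl)))
    ... | inj₂ r = id (there (there (∈-map⁺ (sub θ) r)))

  Γ⊩Γ' : ∀ θ → inst θ Γ ⊩ sub θ M → inst θ Γ ⊩ sub θ N → inst θ Γ ⊩* inst θ Γ'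
  Γ⊩Γ' θ a b = a ∷ b ∷ ⊩*-⊆ (inst-⊆ θ (λ m → proj₁ (remove⁻ Γ m)))

  DvDerives-to-Γ' : ∀ θ {a} → DvDerives θ a Γ → DvDerives θ a Γ'
  DvDerives-to-Γ' θ {a} r = ⊩*-trans (All.tabulate derive) r
    where
    derive : ∀ {z} → z ∈ inst θ (dv Γ a) → inst θ (dv Γ' a) ⊩ z
    derive p with ∈-map⁻ (sub θ) p
    ... | e' , m , refl with dv⁻ Γ a m
    ... | e'∈Γ , only with remove⁺ {e} Γ e'∈Γ
    ... | inj₁ refl = compose {θ} (id (∈-map⁺ (sub θ) (dv⁺ Γ' a (here refl) (λ q → only (vars-M q)))))
                                  (id (∈-map⁺ (sub θ) (dv⁺ Γ' a (there (here refl)) (λ q → only (vars-N q)))))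
    ... | inj₂ r = id (∈-map⁺ (sub θ) (dv⁺ Γ' a (there (there r)) only))

  DvDerives-from-Γ' : ∀ θ {b} → inst θ Γ ⊩* inst θ Γ' → DvDerives θ Γ b → DvDerives θ Γ' b
  DvDerives-from-Γ' θ {b} h r = ⊩*-trans (weaken* (inst-⊆ θ (dv-anti b Γ Γ' varsΓ⊆varsΓ')) r) h

  DvDerives-Γ-Γ' : ∀ θ → DvDerives θ Γ Γ'
  DvDerives-Γ-Γ' θ =
    weaken* (inst-⊆ θ (λ m → dv⁺ Γ' Γ m (λ q → varsΓ'⊆varsΓ (varsL⁺ Γ' m q)))) (Γ'⊩Γ θ)

  lighter : ∀ θ → suc (hypsSize θ Γ') ≤ hypsSize θ Γ
  lighter θ = begin
    suc (size (sub θ M) + (size (sub θ N) + hypsSize θ (remove e Γ)))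
      ≡⟨ cong suc (sym (+-assoc (size (sub θ M)) _ _)) ⟩
    suc (size (sub θ M) + size (sub θ N)) + hypsSize θ (remove e Γ)
      ≡⟨ cong (_+ hypsSize θ (remove e Γ)) (sym (size-e θ)) ⟩
    size (sub θ e) + hypsSize θ (remove e Γ)
      ≤⟨ hypsSize-remove θ e Γ e∈Γ ⟩
    hypsSize θ Γ ∎
    where open ≤-Reasoning

  N-within : ∀ θ → size (sub θ N) ≤ hypsSize θ Γ'
  N-within θ = ≤-trans (m≤m+n _ _) (m≤n+m _ (size (sub θ M)))

record Invariant (θ : Subst) (D : List Con) : Set where
  field
    ground : GroundSubst θ
    solves : All (Sat θ) D
    monotone : Monotone θ D
    originated : Originated ∅ D

record Step (θ : Subst) (D : List Con) : Set where
  field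
    ρ : Subst
    D' : List Con
    θ' : Subst
    reduces : D ↝[ ρ ] D'
    factors : Factors θ ρ θ'
    invariant : Invariant θ' D'
    decreases : W θ' D' < W θ D

record Replacement (θ : Subst) (c : Con) (Y : List Con) : Set₁ where
  field
    solves : All (Sat θ) Y
    monotone-before : ∀ {a} → DvDerives θ a (hyps c) → All (DvDerives θ a) (map hyps Y)
    monotone-after : ∀ {b} → DvDerives θ (hyps c) b → All (λ y → DvDerives θ y b) (map hyps Y)
    monotone-within : AllPairs (DvDerives θ) (map hyps Y)
    originated : ∀ {K} → (∀ x → x ∈ varsL (hyps c) → K x) → Originated K Y
    keeps-vars : varsCon c ⊆ varsC Y
    lighter : W θ Y < weight θ c

replace-step : ∀ {θ} S {c} Y R → (S ++ c ∷ R) ↝[ ε ] (S ++ Y ++ R) →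
               Invariant θ (S ++ c ∷ R) → Replacement θ c Y → Step θ (S ++ c ∷ R)
replace-step {θ} S Y R red inv rep = record
  { ρ = ε ; D' = S ++ Y ++ R ; θ' = θ ; reduces = red ; factors = λ y → refl
  ; invariant = record
    { ground = ground
    ; solves = All-replace S Y solves R.solves
    ; monotone = Monotone-replace S Y R monotone (λ {a} → R.monotone-before {a}) (λ {b} → R.monotone-after {b})
                   R.monotone-within
    ; originated = Originated-replace S Y originated R.originated R.keeps-vars }
  ; decreases = W-replace θ S Y R R.lighter }
  where
  open Invariant inv
  module R = Replacement rep

to-right : ∀ {θ} Γ U → inst θ Γ ⊩R sub θ U →
           Replacement θ ⟨ proper , Γ ⊩? U ⟩ (⟨ right , Γ ⊩? U ⟩ ∷ [])
to-right {θ} Γ U d = record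
  { solves = d ∷ []
  ; monotone-before = λ r → r ∷ []
  ; monotone-after = λ r → r ∷ []
  ; monotone-within = [] ∷ []
  ; originated = λ hc → hc , tt
  ; keeps-vars = ∈-++⁺ˡ
  ; lighter = subst (_< weight θ ⟨ proper , Γ ⊩? U ⟩) (sym (+-identityʳ _))
                    (m<n+m (size (sub θ U)) (s≤s z≤n)) }

split-goal : ∀ {θ e M₁ M₂} → Built e M₁ M₂ → ∀ Γ →
             inst θ Γ ⊩R sub θ M₁ → inst θ Γ ⊩R sub θ M₂ →
             Replacement θ ⟨ right , Γ ⊩? e ⟩ (⟨ right , Γ ⊩? M₁ ⟩ ∷ ⟨ right , Γ ⊩? M₂ ⟩ ∷ [])
split-goal {θ} {e} {M₁} {M₂} b Γ d₁ d₂ = record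
  { solves = d₁ ∷ d₂ ∷ []
  ; monotone-before = λ r → r ∷ r ∷ []
  ; monotone-after = λ r → r ∷ r ∷ []
  ; monotone-within = (DvDerives-refl θ Γ ∷ []) ∷ [] ∷ []
  ; originated = λ hc → hc , (λ x p → inj₁ (hc x p)) , tt
  ; keeps-vars = keeps-vars
  ; lighter = subst₂ _<_ (cong (size (sub θ M₁) +_) (sym (+-identityʳ _))) (sym (size-e θ)) ≤-refl }
  where
  open Built b
  keeps-vars : varsL Γ ++ vars e ⊆ (varsL Γ ++ vars M₁) ++ (varsL Γ ++ vars M₂) ++ []
  keeps-vars p with ∈-++⁻ (varsL Γ) p
  ... | inj₁ q = ∈-++⁺ˡ (∈-++⁺ˡ q)
  ... | inj₂ q with vars-e q
  ...   | inj₁ r = ∈-++⁺ˡ (∈-++⁺ʳ (varsL Γ) r)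
  ...   | inj₂ r = ∈-++⁺ʳ (varsL Γ ++ vars M₁) (∈-++⁺ˡ (∈-++⁺ʳ (varsL Γ) r))

square-mono : ∀ {a b} → suc a ≤ b → suc a * suc a < suc b * suc b
square-mono le = *-mono-< (s≤s le) (s≤s le)

open-pair : ∀ {θ M N} Γ U (e∈Γ : pair M N ∈ Γ) → inst θ Γ ⊩ sub θ U →
            Replacement θ ⟨ proper , Γ ⊩? U ⟩ (⟨ proper , Opening.Γ' (built-pair M N) Γ e∈Γ ⊩? U ⟩ ∷ [])
open-pair {θ} {M} {N} Γ U e∈Γ dU = record
  { solves = ⊩-trans (Γ'⊩Γ θ) dU ∷ []
  ; monotone-before = λ {a} r → DvDerives-to-Γ' θ {a} r ∷ []
  ; monotone-after = λ {b} r → DvDerives-from-Γ' θ {b} Γ⊩Γ'-θ r ∷ []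
  ; monotone-within = [] ∷ []
  ; originated = λ hc → (λ x p → hc x (varsΓ'⊆varsΓ p)) , tt
  ; keeps-vars = keeps-vars
  ; lighter = subst (_< weight θ ⟨ proper , Γ ⊩? U ⟩) (sym (+-identityʳ _))
                    (+-monoˡ-< (size (sub θ U)) (square-mono (lighter θ))) }
  where
  open Opening (built-pair M N) Γ e∈Γ
  Γ⊩Γ'-θ : inst θ Γ ⊩* inst θ Γ'
  Γ⊩Γ'-θ = Γ⊩Γ' θ (fst⊩ (id (∈-map⁺ (sub θ) e∈Γ))) (snd⊩ (id (∈-map⁺ (sub θ) e∈Γ)))
  keeps-vars : varsL Γ ++ vars U ⊆ (varsL Γ' ++ vars U) ++ []
  keeps-vars p with ∈-++⁻ (varsL Γ) p
  ... | inj₁ q = ∈-++⁺ˡ (∈-++⁺ˡ (varsΓ⊆varsΓ' q))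
  ... | inj₂ q = ∈-++⁺ˡ (∈-++⁺ʳ (varsL Γ') q)

-- The arithmetic behind C5: a key of size k ≤ h' together with a proper
-- constraint over hypotheses of size h' < h weighs less than the same goal
-- over hypotheses of size h.
key-and-opened-lighter : ∀ {k h h' u} → k ≤ h' → suc h' ≤ h →
                         k + (suc h' * suc h' + u + 0) < suc h * suc h + u
key-and-opened-lighter {k} {h} {h'} {u} k≤h' h'<h = begin-strict
  k + (suc h' * suc h' + u + 0) ≡⟨ cong (k +_) (+-identityʳ _) ⟩
  k + (suc h' * suc h' + u)     ≡⟨ sym (+-assoc k _ u) ⟩
  k + suc h' * suc h' + u       <⟨ +-monoˡ-< u key+opened ⟩
  suc h * suc h + u             ∎
  where
  open ≤-Reasoning
  key+opened : k + suc h' * suc h' < suc h * suc h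
  key+opened = begin-strict
    k + suc h' * suc h'        ≤⟨ +-monoˡ-≤ (suc h' * suc h') k≤h' ⟩
    h' + suc h' * suc h'       <⟨ +-monoˡ-< (suc h' * suc h') (n<1+n h') ⟩
    suc h' + suc h' * suc h'   ≡⟨ sym (*-suc (suc h') (suc h')) ⟩
    suc h' * suc (suc h')      ≤⟨ *-mono-≤ (≤-trans h'<h (n≤1+n h)) (s≤s h'<h) ⟩
    suc h * suc h              ∎

open-enc : ∀ {θ M K} Γ U (e∈Γ : enc M K ∈ Γ) → inst θ Γ ⊩R sub θ K → inst θ Γ ⊩ sub θ U →
           Replacement θ ⟨ proper , Γ ⊩? U ⟩
             (⟨ right , Γ ⊩? K ⟩ ∷ ⟨ proper , Opening.Γ' (built-enc M K) Γ e∈Γ ⊩? U ⟩ ∷ [])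
open-enc {θ} {M} {K} Γ U e∈Γ dK dU = record
  { solves = dK ∷ ⊩-trans (Γ'⊩Γ θ) dU ∷ []
  ; monotone-before = λ {a} r → r ∷ DvDerives-to-Γ' θ {a} r ∷ []
  ; monotone-after = λ {b} r → r ∷ DvDerives-from-Γ' θ {b} Γ⊩Γ'-θ r ∷ []
  ; monotone-within = (DvDerives-Γ-Γ' θ ∷ []) ∷ [] ∷ []
  ; originated = λ hc → hc , (λ x p → inj₁ (hc x (varsΓ'⊆varsΓ p))) , tt
  ; keeps-vars = keeps-vars
  ; lighter = key-and-opened-lighter (N-within θ) (lighter θ) }
  where
  open Opening (built-enc M K) Γ e∈Γ
  Γ⊩Γ'-θ : inst θ Γ ⊩* inst θ Γ'
  Γ⊩Γ'-θ = Γ⊩Γ' θ (decrypt⊩ (id (∈-map⁺ (sub θ) e∈Γ)) (⊩R⇒⊩ dK)) (⊩R⇒⊩ dK)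
  keeps-vars : varsL Γ ++ vars U ⊆ (varsL Γ ++ vars K) ++ (varsL Γ' ++ vars U) ++ []
  keeps-vars p with ∈-++⁻ (varsL Γ) p
  ... | inj₁ q = ∈-++⁺ˡ (∈-++⁺ˡ q)
  ... | inj₂ q = ∈-++⁺ʳ (varsL Γ ++ vars K) (∈-++⁺ˡ (∈-++⁺ʳ (varsL Γ') q))

Sat-sub : ∀ {θ σ θ'} → Factors θ σ θ' → ∀ c → Sat θ c → Sat θ' (subC σ c)
Sat-sub f ⟨ right , Γ ⊩? M ⟩ d = subst₂ _⊩R_ (sym (inst-factor f Γ)) (sub-factor f M) d
Sat-sub f ⟨ proper , Γ ⊩? M ⟩ d = subst₂ _⊩_ (sym (inst-factor f Γ)) (sub-factor f M) d

Monotone-sub : ∀ {θ σ θ'} → Factors θ σ θ' → ∀ D → Monotone θ D → Monotone θ' (subCs σ D)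
Monotone-sub {σ = σ} {θ'} f D m =
  subst (AllPairs (DvDerives θ')) (sym (hyps-sub D))
    (AllPairs.map⁺ (AllPairs.map (λ {a} {b} → DvDerives-sub f {a} {b}) m))
  where
  hyps-sub : ∀ D → map hyps (subCs σ D) ≡ map (inst σ) (map hyps D)
  hyps-sub [] = refl
  hyps-sub (c ∷ D) = cong (_ ∷_) (hyps-sub D)

-- Composing with a constant substitution makes a factor ground without
-- changing its effect on ground messages.
groundify : Subst → Subst
groundify τ = τ ⊙ (λ _ → name 0)

groundify-factors : ∀ {θ σ τ} → GroundSubst θ → Factors θ σ τ → Factors θ σ (groundify τ)
groundify-factors {θ} {σ} {τ} g f y = begin
  θ y                           ≡⟨ sym (ground-fixed (λ _ → name 0) (θ y) (g y)) ⟩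
  sub (λ _ → name 0) (θ y)       ≡⟨ cong (sub (λ _ → name 0)) (f y) ⟩
  sub (λ _ → name 0) (sub τ (σ y)) ≡⟨ sym (sub-⊙ τ (λ _ → name 0) (σ y)) ⟩
  sub (groundify τ) (σ y)        ∎
  where open ≡-Reasoning

groundify-ground : ∀ τ → GroundSubst (groundify τ)
groundify-ground τ y = sub-ground (λ _ → name 0) (τ y) (λ _ → refl)

-- Dropping a constraint c and applying σ keeps origination, provided σ maps
-- the goal variables of c to variables of the σ-image of its hypotheses:
-- everything c contributed then reappears in the earlier constraints.
Originated-drop : ∀ σ S c R → Originated ∅ (S ++ c ∷ R) →
  (∀ {y z} → y ∈ vars (goal c) → z ∈ vars (σ y) → ∃ λ y' → y' ∈ varsL (hyps c) × z ∈ vars (σ y')) →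
  Originated ∅ (subCs σ S ++ subCs σ R)
Originated-drop σ S c R orig goal-in-hyps =
  Originated-++⁺ (subCs σ S) (Originated-sub σ S orig-S (λ y ()))
    (Originated-sub σ R orig-R λ
      { y (inj₁ k) z q → inj₂ (varsC-sub⁺ σ S (in-S k) q)
      ; y (inj₂ v) z q → inj₂ (c-in-Sσ v q) })
  where
  orig-S : Originated ∅ S
  orig-S = proj₁ (Originated-++⁻ S orig)
  hyps-in-S : ∀ x → x ∈ varsL (hyps c) → (∅ ∪ ⟦ varsC S ⟧) x
  hyps-in-S = proj₁ (proj₂ (Originated-++⁻ S orig))
  orig-R : Originated ((∅ ∪ ⟦ varsC S ⟧) ∪ ⟦ varsCon c ⟧) R
  orig-R = proj₂ (proj₂ (Originated-++⁻ S orig))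
  in-S : ∀ {y} → (∅ ∪ ⟦ varsC S ⟧) y → y ∈ varsC S
  in-S (inj₂ v) = v
  hyps-in-Sσ : ∀ {y z} → y ∈ varsL (hyps c) → z ∈ vars (σ y) → z ∈ varsC (subCs σ S)
  hyps-in-Sσ w q = varsC-sub⁺ σ S (in-S (hyps-in-S _ w)) q
  c-in-Sσ : ∀ {y z} → y ∈ varsCon c → z ∈ vars (σ y) → z ∈ varsC (subCs σ S)
  c-in-Sσ v q with ∈-++⁻ (varsL (hyps c)) v
  ... | inj₁ w = hyps-in-Sσ w q
  ... | inj₂ w = let (y' , w' , q') = goal-in-hyps w q in hyps-in-Sσ w' q'

-- C1: a right constraint Γ ⊩ M whose instance is the instance of some N ∈ Γ
-- is closed by the mgu σ of M and N.  θ factors through σ, and the goal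
-- variables of M become those of Nσ with N ∈ Γ.
unify-step : ∀ {θ} S R Γ M N → ¬ IsVar M → N ∈ Γ → sub θ M ≡ sub θ N →
             Invariant θ (S ++ ⟨ right , Γ ⊩? M ⟩ ∷ R) → Step θ (S ++ ⟨ right , Γ ⊩? M ⟩ ∷ R)
unify-step {θ} S R Γ M N M-nv N∈Γ eq inv with mgu θ M N eq
... | σ , unifies , general with general θ eq
... | τ , θ=στ = record
  { ρ = σ ; D' = subCs σ S ++ subCs σ R ; θ' = groundify τ
  ; reduces = C1 S R Γ M N σ M-nv N∈Γ (unifies , general)
  ; factors = factors
  ; invariant = record
    { ground = groundify-ground τ
    ; solves = subst (All _) subCs-++ (All.map⁺ (All.map (λ {c} → Sat-sub factors c) (All-replace S [] solves [])))
    ; monotone = subst (Monotone _) subCs-++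
                   (Monotone-sub factors (S ++ R) (Monotone-replace S [] R monotone (λ _ → []) (λ _ → []) []))
    ; originated = Originated-drop σ S _ R originated M-in-N }
  ; decreases = subst (_< W θ (S ++ _ ∷ R)) (sym (trans (cong (W _) (sym subCs-++)) (W-sub factors (S ++ R))))
                  (W-replace θ S [] R (size-pos (sub θ M))) }
  where
  open Invariant inv
  factors : Factors θ σ (groundify τ)
  factors = groundify-factors {σ = σ} {τ} ground θ=στ
  subCs-++ : subCs σ (S ++ R) ≡ subCs σ S ++ subCs σ R
  subCs-++ = map-++ (subC σ) S R
  M-in-N : ∀ {y z} → y ∈ vars M → z ∈ vars (σ y) → ∃ λ y' → y' ∈ varsL Γ × z ∈ vars (σ y')
  M-in-N w q = let (y' , y'∈N , q') = vars-sub⁻ σ N (subst (λ t → _ ∈ vars t) unifies (vars-sub⁺ σ M w q))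
               in y' , varsL⁺ Γ N∈Γ y'∈N , q'

Solved : Con → Set
Solved c = (kind c ≡ right) × IsVar (goal c)

isVar? : ∀ e → Dec (IsVar e)
isVar? (var x) = yes (x , refl)
isVar? (name _) = no λ ()
isVar? (pair _ _) = no λ ()
isVar? (enc _ _) = no λ ()

IsPair : Msg → Set
IsPair e = ∃₂ λ M N → e ≡ pair M N

Openable : Subst → List Msg → Msg → Set
Openable θ Γ e = ∃₂ λ M K → e ≡ enc M K × inst θ Γ ⊩R sub θ K

isPair? : ∀ e → Dec (IsPair e)
isPair? (pair M N) = yes (M , N , refl)
isPair? (name _) = no λ ()
isPair? (var _) = no λ ()
isPair? (enc _ _) = no λ ()

openable? : ∀ θ Γ e → Dec (Openable θ Γ e)
openable? θ Γ (enc M K) with ⊩R? (inst θ Γ) (sub θ K)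
... | yes d = yes (M , K , refl , d)
... | no ¬d = no λ { (_ , _ , refl , d) → ¬d d }
openable? θ Γ (name _) = no λ ()
openable? θ Γ (var _) = no λ ()
openable? θ Γ (pair _ _) = no λ ()

-- Γ₀, the non-variable hypotheses of Γ, derives the instance of every
-- variable hypothesis x of Γ that is the goal of an earlier solved
-- constraint Σ ⊩ x: the part of Γ over variables of Σ derives Σ, hence x,
-- and its variables are goals of yet earlier constraints.
module NonVariables (θ : Subst) (Γ : List Msg) where

  nonVar? : ∀ e → Dec (¬ IsVar e)
  nonVar? e = ¬? (isVar? e)

  Γ₀ : List Msg
  Γ₀ = filter nonVar? Γ

  Γ₀⁻ : ∀ {e} → e ∈ Γ₀ → e ∈ Γ × ¬ IsVar e
  Γ₀⁻ = ∈-filter⁻ nonVar? {xs = Γ}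

  Γ₀⊆Γ : Γ₀ ⊆ Γ
  Γ₀⊆Γ m = proj₁ (Γ₀⁻ m)

  Recovered : VarSet → Set
  Recovered K = ∀ y → K y → var y ∈ Γ → inst θ Γ₀ ⊩ θ y

  member-derivable : ∀ {K} → Recovered K → ∀ {e} → e ∈ Γ → (∀ {x} → x ∈ vars e → K x) →
                     inst θ Γ₀ ⊩ sub θ e
  member-derivable rec {e} m k with isVar? e
  ... | yes (x , refl) = rec x (k (here refl)) m
  ... | no e-nv = id (∈-map⁺ (sub θ) (∈-filter⁺ nonVar? m e-nv))

  recover : ∀ {K} S → Originated K S → All Solved S → All (Sat θ) S →
            All (λ ci → DvDerives θ (hyps ci) Γ) S → Recovered K → Recovered (K ∪ ⟦ varsC S ⟧)
  recover [] _ _ _ _ rec y (inj₁ k) m = rec y k m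
  recover {K} (⟨ _ , Σi ⊩? _ ⟩ ∷ S) (hc , orig) ((refl , xi , refl) ∷ solved) (sat ∷ sats) (dvd ∷ dvds) rec
    = λ { y (inj₁ k) m → rec' y (inj₁ (inj₁ k)) m
        ; y (inj₂ v) m → regroup y (∈-++⁻ (varsCon ci) v) m }
    where
    ci : Con
    ci = ⟨ right , Σi ⊩? var xi ⟩
    rec-head : Recovered (K ∪ ⟦ varsCon ci ⟧)
    rec-head y (inj₁ k) m = rec y k m
    rec-head y (inj₂ v) m with ∈-++⁻ (varsL Σi) v
    ... | inj₁ w = rec y (hc y w) m
    ... | inj₂ (here refl) = ⊩-trans (⊩*-trans Γ₀⊩dv dvd) (⊩R⇒⊩ sat)
      where
      Γ₀⊩dv : inst θ Γ₀ ⊩* inst θ (dv Γ Σi)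
      Γ₀⊩dv = All.tabulate λ p → let (e , e∈dv , e≡) = ∈-map⁻ (sub θ) p
                                     (e∈Γ , only) = dv⁻ Γ Σi e∈dv
                                 in subst (inst θ Γ₀ ⊩_) (sym e≡)
                                      (member-derivable rec e∈Γ (λ q → hc _ (only q)))
    rec' : Recovered ((K ∪ ⟦ varsCon ci ⟧) ∪ ⟦ varsC S ⟧)
    rec' = recover S orig solved sats dvds rec-head
    regroup : ∀ y → y ∈ varsCon ci ⊎ y ∈ varsC S → var y ∈ Γ → inst θ Γ₀ ⊩ θ y
    regroup y (inj₁ w) m = rec' y (inj₁ (inj₂ w)) m
    regroup y (inj₂ w) m = rec' y (inj₂ w) m

  Γ₀⊩Γ : ∀ S → Originated ∅ S → All Solved S → All (Sat θ) S →
         All (λ ci → DvDerives θ (hyps ci) Γ) S →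
         (∀ x → x ∈ varsL Γ → (∅ ∪ ⟦ varsC S ⟧) x) → inst θ Γ₀ ⊩* inst θ Γ
  Γ₀⊩Γ S orig solved sats dvds covered = All.tabulate λ p →
    let (e , e∈Γ , e≡) = ∈-map⁻ (sub θ) p
    in subst (inst θ Γ₀ ⊩_) (sym e≡)
         (member-derivable (recover S orig solved sats dvds (λ y ())) e∈Γ (λ q → covered _ (varsL⁺ Γ e∈Γ q)))

  analysed-Γ₀ : ¬ Any IsPair Γ → ¬ Any (Openable θ Γ) Γ → Analysed (inst θ Γ₀)
  analysed-Γ₀ no-pair no-enc = no-pair' , no-enc'
    where
    no-pair' : ∀ {A B} → pair A B ∉ inst θ Γ₀
    no-pair' p with ∈-map⁻ (sub θ) p
    ... | pair a b , m , _ = no-pair (lose (Γ₀⊆Γ m) (a , b , refl))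
    ... | var x , m , _ = proj₂ (Γ₀⁻ m) (x , refl)
    no-enc' : ∀ {A B} → enc A B ∈ inst θ Γ₀ → ¬ (inst θ Γ₀ ⊩R B)
    no-enc' p d with ∈-map⁻ (sub θ) p
    ... | enc a b , m , refl = no-enc (lose (Γ₀⊆Γ m) (a , b , refl , weakenR (inst-⊆ θ Γ₀⊆Γ) d))
    ... | var x , m , _ = proj₂ (Γ₀⁻ m) (x , refl)

focus-sat : ∀ {θ} S {c R} → Invariant θ (S ++ c ∷ R) → Sat θ c
focus-sat S inv = All.head (All.++⁻ʳ S (Invariant.solves inv))

stuck : ∀ {θ} S R Γ U → All Solved S → Invariant θ (S ++ ⟨ proper , Γ ⊩? U ⟩ ∷ R) →
        ¬ Any IsPair Γ → ¬ Any (Openable θ Γ) Γ → inst θ Γ ⊩R sub θ U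
stuck {θ} S R Γ U solved inv no-pair no-enc =
  weakenR (inst-⊆ θ Γ₀⊆Γ)
    (analysed⇒right (analysed-Γ₀ no-pair no-enc) (⊩-trans Γ₀⊩Γθ (focus-sat S inv)))
  where
  open Invariant inv
  open NonVariables θ Γ
  orig : Originated ∅ S × Originated (∅ ∪ ⟦ varsC S ⟧) (⟨ proper , Γ ⊩? U ⟩ ∷ R)
  orig = Originated-++⁻ S originated
  Γ₀⊩Γθ : inst θ Γ₀ ⊩* inst θ Γ
  Γ₀⊩Γθ = Γ₀⊩Γ S (proj₁ orig) solved (All.++⁻ˡ S solves)
            (All.map⁻ (AllPairs-before (map hyps S) (subst (AllPairs _) (map-++ hyps S _) monotone)))
            (proj₁ (proj₂ orig))

open-pair-step : ∀ {θ M N} S R Γ U → pair M N ∈ Γ → Invariant θ (S ++ ⟨ proper , Γ ⊩? U ⟩ ∷ R) →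
                 Step θ (S ++ ⟨ proper , Γ ⊩? U ⟩ ∷ R)
open-pair-step {M = M} {N} S R Γ U e∈Γ inv =
  replace-step S _ R (C4 S R Γ Γ' (remove (pair M N) Γ) M N U Γ≈e∷rest e∉rest ≈ˢ-refl)
               inv (open-pair Γ U e∈Γ (focus-sat S inv))
  where open Opening (built-pair M N) Γ e∈Γ

open-enc-step : ∀ {θ M K} S R Γ U → enc M K ∈ Γ → inst θ Γ ⊩R sub θ K →
                Invariant θ (S ++ ⟨ proper , Γ ⊩? U ⟩ ∷ R) → Step θ (S ++ ⟨ proper , Γ ⊩? U ⟩ ∷ R)
open-enc-step {M = M} {K} S R Γ U e∈Γ dK inv =
  replace-step S _ R (C5 S R Γ Γ' (remove (enc M K) Γ) M K U Γ≈e∷rest e∉rest ≈ˢ-refl)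
               inv (open-enc Γ U e∈Γ dK (focus-sat S inv))
  where open Opening (built-enc M K) Γ e∈Γ

-- Progress for a proper constraint: C3 if its instance is right-derivable,
-- otherwise C4 or C5, one of which applies by `stuck`.
proper-step : ∀ {θ} S R Γ U → All Solved S → Invariant θ (S ++ ⟨ proper , Γ ⊩? U ⟩ ∷ R) →
              Step θ (S ++ ⟨ proper , Γ ⊩? U ⟩ ∷ R)
proper-step {θ} S R Γ U solved inv with ⊩R? (inst θ Γ) (sub θ U)
... | yes d = replace-step S _ R (C3 S R Γ U) inv (to-right Γ U d)
... | no ¬d with Any.any? isPair? Γ | Any.any? (openable? θ Γ) Γ
... | yes has-pair | _ with find has-pair
...   | _ , e∈Γ , (M , N , refl) = open-pair-step S R Γ U e∈Γ inv
proper-step S R Γ U solved inv | no ¬d | no _ | yes has-enc with find has-enc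
...   | _ , e∈Γ , (M , K , refl , dK) = open-enc-step S R Γ U e∈Γ dK inv
proper-step S R Γ U solved inv | no ¬d | no no-pair | no no-enc =
  ⊥-elim (¬d (stuck S R Γ U solved inv no-pair no-enc))

-- Progress for a right constraint with a non-variable goal, following the
-- last rule of the right derivation of its instance: C1 for an axiom, C2
-- for a pairing or encryption.
right-step : ∀ {θ} S R Γ M → ¬ IsVar M → inst θ Γ ⊩R sub θ M →
             Invariant θ (S ++ ⟨ right , Γ ⊩? M ⟩ ∷ R) →
             Step θ (S ++ ⟨ right , Γ ⊩? M ⟩ ∷ R)
right-step S R Γ (var x) M-nv _ _ = ⊥-elim (M-nv (x , refl))
right-step {θ} S R Γ M M-nv (id m) inv =
  let (N , N∈Γ , Mθ≡Nθ) = ∈-map⁻ (sub θ) m in unify-step S R Γ M N M-nv N∈Γ Mθ≡Nθ inv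
right-step S R Γ (pair M₁ M₂) _ (pR d₁ d₂) inv =
  replace-step S _ R (C2p S R Γ M₁ M₂) inv (split-goal (built-pair M₁ M₂) Γ d₁ d₂)
right-step S R Γ (enc M₁ M₂) _ (eR d₁ d₂) inv =
  replace-step S _ R (C2e S R Γ M₁ M₂) inv (split-goal (built-enc M₁ M₂) Γ d₁ d₂)

progress : ∀ {θ} S c R → All Solved S → ¬ Solved c → Invariant θ (S ++ c ∷ R) → Step θ (S ++ c ∷ R)
progress S ⟨ proper , Γ ⊩? U ⟩ R solved _ inv = proper-step S R Γ U solved inv
progress S ⟨ right , Γ ⊩? M ⟩ R solved unsolved inv =
  right-step S R Γ M (λ M-var → unsolved (refl , M-var)) (focus-sat S inv) inv

solved? : ∀ c → Dec (Solved c)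
solved? ⟨ right , Γ ⊩? var x ⟩ = yes (refl , x , refl)
solved? ⟨ right , Γ ⊩? name a ⟩ = no λ { (_ , _ , ()) }
solved? ⟨ right , Γ ⊩? pair _ _ ⟩ = no λ { (_ , _ , ()) }
solved? ⟨ right , Γ ⊩? enc _ _ ⟩ = no λ { (_ , _ , ()) }
solved? ⟨ proper , Γ ⊩? M ⟩ = no λ { (() , _) }

data FirstUnsolved (D : List Con) : Set where
  all-solved : SolvedForm D → FirstUnsolved D
  first-unsolved : ∀ S c R → D ≡ S ++ c ∷ R → All Solved S → ¬ Solved c → FirstUnsolved D

first-unsolved? : ∀ D → FirstUnsolved D
first-unsolved? [] = all-solved []
first-unsolved? (c ∷ D) with solved? c
... | no unsolved = first-unsolved [] c D refl [] unsolved
... | yes s with first-unsolved? D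
...   | all-solved ss = all-solved (s ∷ ss)
...   | first-unsolved S c' R refl ss unsolved = first-unsolved (c ∷ S) c' R refl (s ∷ ss) unsolved

Reaches : Subst → List Con → Set
Reaches θ D = ∃₂ λ (σ : Subst) (D' : List Con) →
  (D ↝*[ σ ] D') × SolvedForm D' × (∃ λ (γ : Subst) → Solution γ D' × Factors θ σ γ)

-- Guided steps until solved form; the weight bounds their number.
reach : ∀ n {θ} D → W θ D < n → Invariant θ D → Reaches θ D
reach n D lt inv with first-unsolved? D
... | all-solved sf = ε , D , done , sf , _ , (Invariant.ground inv , Invariant.solves inv) , λ x → refl
reach (suc n) D (s≤s lt) inv | first-unsolved S c R refl solved unsolved
  with progress S c R solved unsolved inv
... | st with reach n (Step.D' st) (≤-trans (Step.decreases st) lt) (Step.invariant st)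
... | σ , D' , reduction , sf , γ , solution , θ'=σγ =
  Step.ρ st ⊙ σ , D' , step (Step.reduces st) reduction , sf , γ , solution ,
  λ x → trans (Step.factors st x) (sub-factor θ'=σγ (Step.ρ st x))

monotone-init : ∀ C → IsDCS C → ∀ θ → Solution θ C → Monotone θ C
monotone-init C (dv-condition , _) θ (ground , solves) =
  subst (AllPairs (DvDerives θ)) (trans (sym (map-tabulate (lookup C) hyps)) (cong (map hyps) (tabulate-lookup C)))
    (AllPairs.tabulate⁺-< λ {i} {j} i<j → dv-condition i j i<j θ (ground , All.take⁺ (toℕ j) solves))

originated-by-index : ∀ K D →
  (∀ k x → x ∈ varsL (hyps (lookup D k)) → K x ⊎ ∃ λ i → i <ᶠ k × x ∈ varsCon (lookup D i)) →
  Originated K D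
originated-by-index K [] f = tt
originated-by-index K (c ∷ D) f = from-K , originated-by-index (K ∪ ⟦ varsCon c ⟧) D shift
  where
  from-K : ∀ x → x ∈ varsL (hyps c) → K x
  from-K x p with f fzero x p
  ... | inj₁ k = k
  shift : ∀ k x → x ∈ varsL (hyps (lookup D k)) →
          (K ∪ ⟦ varsCon c ⟧) x ⊎ ∃ λ i → i <ᶠ k × x ∈ varsCon (lookup D i)
  shift k x p with f (fsuc k) x p
  ... | inj₁ a = inj₁ (inj₁ a)
  ... | inj₂ (fzero , _ , v) = inj₁ (inj₂ v)
  ... | inj₂ (fsuc i , s≤s i<k , v) = inj₂ (i , i<k , v)

-- By condition (2), a hypothesis variable of the k-th constraint first
-- occurs, as a goal variable, in a constraint i < k.
originated-init : ∀ C → IsDCS C → Originated ∅ C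
originated-init C (_ , origin-condition) = originated-by-index ∅ C earlier
  where
  earlier : ∀ k x → x ∈ varsL (hyps (lookup C k)) → ∅ x ⊎ ∃ λ i → i <ᶠ k × x ∈ varsCon (lookup C i)
  earlier k x p with origin-condition x (varsC⁺ C (∈-lookup k) (∈-++⁺ˡ p))
  ... | i , x∈goal , x∉hyps , not-before with Fin.<-cmp i k
  ...   | tri< i<k _ _ = inj₂ (i , i<k , ∈-++⁺ʳ (varsL (hyps (lookup C i))) x∈goal)
  ...   | tri≈ _ refl _ = ⊥-elim (x∉hyps p)
  ...   | tri> _ _ k<i = ⊥-elim (not-before k k<i (∈-++⁺ˡ p))

-- Lemma 6.12: start the guided reduction from C and the given solution; the
-- factorisation θ = σγ even holds for all variables, not only those of C.
lemma6p12 : (C : List Con) → IsDCS C → (θ : Subst) → Solution θ C →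
    ∃₂ λ (σ : Subst) (C' : List Con) →
        (C ↝*[ σ ] C')
      × SolvedForm C'
      × (∃ λ (γ : Subst) → Solution γ C' × (∀ x → x ∈ varsC C → θ x ≡ sub γ (σ x)))
lemma6p12 C dcs θ sol@(ground , solves) =
  let invariant = record { ground = ground ; solves = solves
                         ; monotone = monotone-init C dcs θ sol ; originated = originated-init C dcs }
      (σ , C' , reduction , sf , γ , solution , θ=σγ) = reach (suc (W θ C)) C ≤-refl invariant
  in σ , C' , reduction , sf , γ , solution , λ x _ → θ=σγ x
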